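{- Let $\varphi$ be a quantifier-free $\mathcal{T}$-formula, $\boldsymbol{\alpha}$ a finite set of atoms containing all atoms of $\varphi$, and $\boldsymbol{\beta}$ a finite set of further $\mathcal{T}$-atoms not in $\boldsymbol{\alpha}$. Let $\{C_1,\ldots,C_K\}$ be a set of $\mathcal{T}$-lemmas on $\boldsymbol{\alpha}\cup\boldsymbol{\beta}$ which rules out $P_{\boldsymbol{\alpha}}(\neg\varphi)$, and let $\mathrm{Text}(\varphi)=\varphi\vee\neg\big(\exists\boldsymbol{\beta}.\bigwedge_{l=1}^K C_l\big)$. Then (i) $\mathrm{Text}(\varphi)\equiv_{\mathcal{T}}\varphi$; (ii) $\varphi\models_p\mathrm{Text}(\varphi)$; (iii) $\mathrm{Text}(\varphi)$ is $\mathcal{T}$-extended with respect to $\boldsymbol{\alpha}$.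
   Context: $\mathcal{T}$-formulas are quantifier-free formulas built by Boolean connectives from $\mathcal{T}$-atoms and Boolean atoms. The Boolean abstraction $\mathcal{T}2\mathcal{B}$ maps each atom bijectively to a fresh Boolean variable (homomorphically on formulas) with inverse (refinement) $\mathcal{B}2\mathcal{T}$; $\varphi\models_p\psi$ means $\mathcal{T}2\mathcal{B}(\varphi)\models\mathcal{T}2\mathcal{B}(\psi)$ propositionally, and $\equiv_{\mathcal{B}}$ is mutual $\models_p$. $\equiv_{\mathcal{T}}$ is equivalence modulo $\mathcal{T}$. A $\mathcal{T}$-lemma is a $\mathcal{T}$-valid clause. For a formula $\psi$ over $\boldsymbol{\alpha}\cup\boldsymbol{\beta}$, $\exists\boldsymbol{\beta}.\psi$ denotes $\mathcal{B}2\mathcal{T}(\exists\mathbf{B}.\mathcal{T}2\mathcal{B}(\psi))$ where $\mathbf{B}=\mathcal{T}2\mathcal{B}(\boldsymbol{\beta})$. A total truth assignment on $\boldsymbol{\alpha}$ is a conjunction containing, for each $a\in\boldsymbol{\alpha}$, exactly one of $a,\neg a$. $P_{\boldsymbol{\alpha}}(\psi)$ is the set of $\mathcal{T}$-unsatisfiable total truth assignments $\rho$ on $\boldsymbol{\alpha}$ with $\rho\models_p\psi$. A set $\{C_1,\dots,C_K\}$ of $\mathcal{T}$-lemmas on $\boldsymbol{\alpha}\cup\boldsymbol{\beta}$ rules out a set $\{\rho_1,\dots,\rho_M\}$ of $\mathcal{T}$-unsatisfiable total truth assignments on $\boldsymbol{\alpha}$ iff $\bigvee_{j=1}^M\rho_j\wedge\bigwedge_{l=1}^K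 C_l\equiv_{\mathcal{B}}\bot$. A formula $\psi$ is $\mathcal{T}$-extended with respect to $\boldsymbol{\alpha}$ iff $P_{\boldsymbol{\alpha}}(\neg\psi)=\emptyset$. -}

module Defs where

open import Data.Bool using (Bool; true; false; _∧_; _∨_; not; if_then_else_)
open import Data.List using (List; []; _∷_; _++_; foldr; map)
open import Data.List.Membership.Propositional using (_∈_; _∉_)
open import Data.List.Relation.Unary.All using (All)
open import Data.Product using (Σ; _×_; _,_)
open import Relation.Binary.Definitions using (DecidableEquality)
open import Relation.Binary.PropositionalEquality using (_≡_)
open import Relation.Nullary using (¬_; yes; no)

record Theory : Set₁ where
  field
    Atom   : Set
    _≟_    : DecidableEquality Atom
    Model  : Set
    holds  : Model → Atom → Bool

module _ (𝒯 : Theory) where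
  open Theory 𝒯

  -- Since T2B is a bijection
  -- atoms ↔ Boolean variables, the Boolean abstraction of a formula is the
  -- same syntax read propositionally (valuations Atom → Bool).
  data Formula : Set where
    atom : Atom → Formula
    ⊤f ⊥f : Formula
    ¬f_  : Formula → Formula
    _∧f_ _∨f_ : Formula → Formula → Formula

  atoms : Formula → List Atom
  atoms (atom a) = a ∷ []
  atoms ⊤f = []
  atoms ⊥f = []
  atoms (¬f φ) = atoms φ
  atoms (φ ∧f ψ) = atoms φ ++ atoms ψ
  atoms (φ ∨f ψ) = atoms φ ++ atoms ψ

  eval : (Atom → Bool) → Formula → Bool
  eval v (atom a) = v a
  eval v ⊤f = true
  eval v ⊥f = false
  eval v (¬f φ) = not (eval v φ)
  eval v (φ ∧f ψ) = eval v φ ∧ eval v ψ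
  eval v (φ ∨f ψ) = eval v φ ∨ eval v ψ

  _⊨T_ : Model → Formula → Set
  M ⊨T φ = eval (holds M) φ ≡ true

  T-satisfiable : Formula → Set
  T-satisfiable φ = Σ Model λ M → M ⊨T φ

  T-unsatisfiable : Formula → Set
  T-unsatisfiable φ = ¬ T-satisfiable φ

  _≡T_ : Formula → Formula → Set
  φ ≡T ψ = ∀ (M : Model) → eval (holds M) φ ≡ eval (holds M) ψ

  _⊨p_ : Formula → Formula → Set
  φ ⊨p ψ = ∀ (v : Atom → Bool) → eval v φ ≡ true → eval v ψ ≡ true

  P-satisfiable : Formula → Set
  P-satisfiable φ = Σ (Atom → Bool) λ v → eval v φ ≡ true

  Literal : Set
  Literal = Bool × Atom

  litFormula : Literal → Formula
  litFormula (true  , a) = atom a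
  litFormula (false , a) = ¬f atom a

  Clause : Set
  Clause = List Literal

  clauseFormula : Clause → Formula
  clauseFormula c = foldr (λ l φ → litFormula l ∨f φ) ⊥f c

  clauseAtoms : Clause → List Atom
  clauseAtoms c = map (λ { (_ , a) → a }) c

  bigAnd : List Formula → Formula
  bigAnd = foldr _∧f_ ⊤f

  T-lemma : Clause → Set
  T-lemma c = ∀ (M : Model) → M ⊨T clauseFormula c

  ClauseOn : List Atom → Clause → Set
  ClauseOn γ c = All (_∈ γ) (clauseAtoms c)

  substB : Atom → Bool → Formula → Formula
  substB x b (atom a) with x ≟ a
  ... | yes _ = if b then ⊤f else ⊥f
  ... | no  _ = atom a
  substB x b ⊤f = ⊤f
  substB x b ⊥f = ⊥f
  substB x b (¬f φ) = ¬f substB x b φ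
  substB x b (φ ∧f ψ) = substB x b φ ∧f substB x b ψ
  substB x b (φ ∨f ψ) = substB x b φ ∨f substB x b ψ

  -- propositional existential quantification (Shannon expansion):
  -- ∃x.ψ := ψ[x:=⊤] ∨ ψ[x:=⊥], and ∃β.ψ iterated over the list β
  -- (this is B2T(∃B.T2B(ψ)), with T2B the identity on syntax).
  ∃p : Atom → Formula → Formula
  ∃p x ψ = substB x true ψ ∨f substB x false ψ

  ∃ps : List Atom → Formula → Formula
  ∃ps β ψ = foldr ∃p ψ β

  assignment : List Atom → (Atom → Bool) → Formula
  assignment α τ = bigAnd (map (λ a → litFormula (τ a , a)) α)

  TotalAssignment : List Atom → Formula → Set
  TotalAssignment α ρ = Σ (Atom → Bool) λ τ → ρ ≡ assignment α τ

  P : List Atom → Formula → Formula → Set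
  P α ψ ρ = TotalAssignment α ρ × T-unsatisfiable ρ × (ρ ⊨p ψ)

  -- {C_1..C_K} rules out a set S of T-unsat total assignments iff
  -- (⋁_{ρ∈S} ρ) ∧ ⋀_l C_l ≡_B ⊥, i.e. no valuation satisfies it.
  -- A valuation satisfies ⋁_{ρ∈S} ρ iff it satisfies some ρ ∈ S.
  RulesOut : List Clause → (Formula → Set) → Set
  RulesOut Cs S = ∀ (v : Atom → Bool) →
    ¬ ((Σ Formula λ ρ → S ρ × eval v ρ ≡ true)
       × eval v (bigAnd (map clauseFormula Cs)) ≡ true)

  T-extended : List Atom → Formula → Set
  T-extended α ψ = ∀ (ρ : Formula) → ¬ P α (¬f ψ) ρ

  Text : List Atom → List Clause → Formula → Formula
  Text β Cs φ = φ ∨f (¬f ∃ps β (bigAnd (map clauseFormula Cs)))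

-- A T-model M satisfies every T-lemma, hence ⋀ C_l, hence ∃β.⋀ C_l; so the
-- added disjunct ¬∃β.⋀ C_l is false in every model, which gives (i), and (ii)
-- is ∨-introduction.  For (iii), a total assignment ρ on α entailing ¬Text(φ)
-- entails ¬φ, and its own valuation τ satisfies ∃β.⋀ C_l; eliminating the
-- quantifier yields a valuation that differs from τ only on β, so (α and β
-- being disjoint) still satisfies ρ, and also satisfies ⋀ C_l.  That ρ would
-- then lie in P_α(¬φ) without being ruled out.
module Submission where

open import Defs
open import Data.Bool using (Bool; true; false; _∧_; _∨_; not)
open import Data.Bool.Properties using (∨-zeroʳ; ∨-identityʳ; ∨-conicalˡ; ∨-conicalʳ; not-injective)
open import Data.List using (List; []; _∷_; _++_; map)
open import Data.List.Membership.Propositional using (_∈_; _∉_)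
open import Data.List.Relation.Unary.All as All using (All; []; _∷_)
open import Data.List.Relation.Unary.Any using (here; there)
open import Data.Product using (Σ; _×_; _,_; proj₁)
open import Data.Empty using (⊥-elim)
open import Function using (_∘_)
open import Relation.Nullary using (yes; no)
open import Relation.Binary.PropositionalEquality
  using (_≡_; _≢_; refl; sym; trans; cong; cong₂; module ≡-Reasoning)

∨-intro-at : (f : Bool → Bool) (b : Bool) → f b ≡ true → f true ∨ f false ≡ true
∨-intro-at f true  p rewrite p = refl
∨-intro-at f false p rewrite p = ∨-zeroʳ (f true)

∨-elim-at : (f : Bool → Bool) → f true ∨ f false ≡ true → Σ Bool λ b → f b ≡ true
∨-elim-at f p with f true in eq
... | true  = true , eq
... | false = false , p

module _ (𝒯 : Theory) where
  open Theory 𝒯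

  update : (Atom → Bool) → Atom → Bool → Atom → Bool
  update v x b a with x ≟ a
  ... | yes _ = b
  ... | no  _ = v a

  update-self : ∀ v x a → update v x (v x) a ≡ v a
  update-self v x a with x ≟ a
  ... | yes refl = refl
  ... | no  _    = refl

  update-other : ∀ v x b a → a ≢ x → update v x b a ≡ v a
  update-other v x b a a≢x with x ≟ a
  ... | yes refl = ⊥-elim (a≢x refl)
  ... | no  _    = refl

  eval-cong : ∀ {v w} (χ : Formula 𝒯) → (∀ a → v a ≡ w a) → eval 𝒯 v χ ≡ eval 𝒯 w χ
  eval-cong (atom a) v≗w = v≗w a
  eval-cong ⊤f       v≗w = refl
  eval-cong ⊥f       v≗w = refl
  eval-cong (¬f χ)   v≗w = cong not (eval-cong χ v≗w)
  eval-cong (χ ∧f ψ) v≗w = cong₂ _∧_ (eval-cong χ v≗w) (eval-cong ψ v≗w)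
  eval-cong (χ ∨f ψ) v≗w = cong₂ _∨_ (eval-cong χ v≗w) (eval-cong ψ v≗w)

  eval-substB : ∀ v x b (χ : Formula 𝒯) →
                eval 𝒯 v (substB 𝒯 x b χ) ≡ eval 𝒯 (update v x b) χ
  eval-substB v x b (atom a) with x ≟ a
  eval-substB v x true  (atom a) | yes _ = refl
  eval-substB v x false (atom a) | yes _ = refl
  eval-substB v x b     (atom a) | no  _ = refl
  eval-substB v x b ⊤f       = refl
  eval-substB v x b ⊥f       = refl
  eval-substB v x b (¬f χ)   = cong not (eval-substB v x b χ)
  eval-substB v x b (χ ∧f ψ) = cong₂ _∧_ (eval-substB v x b χ) (eval-substB v x b ψ)
  eval-substB v x b (χ ∨f ψ) = cong₂ _∨_ (eval-substB v x b χ) (eval-substB v x b ψ)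

  eval-∃p : ∀ v x (ψ : Formula 𝒯) →
            eval 𝒯 v (∃p 𝒯 x ψ) ≡ eval 𝒯 (update v x true) ψ ∨ eval 𝒯 (update v x false) ψ
  eval-∃p v x ψ = cong₂ _∨_ (eval-substB v x true ψ) (eval-substB v x false ψ)

  ∃p-intro : ∀ x (ψ : Formula 𝒯) → _⊨p_ 𝒯 ψ (∃p 𝒯 x ψ)
  ∃p-intro x ψ v ψ-true = trans (eval-∃p v x ψ)
    (∨-intro-at (λ b → eval 𝒯 (update v x b) ψ) (v x)
      (trans (eval-cong ψ (update-self v x)) ψ-true))

  ∃ps-intro : ∀ β (ψ : Formula 𝒯) → _⊨p_ 𝒯 ψ (∃ps 𝒯 β ψ)
  ∃ps-intro []      ψ v ψ-true = ψ-true
  ∃ps-intro (x ∷ β) ψ v ψ-true = ∃p-intro x (∃ps 𝒯 β ψ) v (∃ps-intro β ψ v ψ-true)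

  ∃p-elim : ∀ v x (ψ : Formula 𝒯) → eval 𝒯 v (∃p 𝒯 x ψ) ≡ true →
            Σ Bool λ b → eval 𝒯 (update v x b) ψ ≡ true
  ∃p-elim v x ψ ∃-true =
    ∨-elim-at (λ b → eval 𝒯 (update v x b) ψ) (trans (sym (eval-∃p v x ψ)) ∃-true)

  ∃ps-elim : ∀ v β (ψ : Formula 𝒯) → eval 𝒯 v (∃ps 𝒯 β ψ) ≡ true →
             Σ (Atom → Bool) λ w → (∀ a → a ∉ β → w a ≡ v a) × eval 𝒯 w ψ ≡ true
  ∃ps-elim v []      ψ ψ-true = v , (λ _ _ → refl) , ψ-true
  ∃ps-elim v (x ∷ β) ψ ∃-true with ∃p-elim v x (∃ps 𝒯 β ψ) ∃-true
  ... | b , ∃β-true with ∃ps-elim (update v x b) β ψ ∃β-true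
  ... | w , w≗off-β , ψ-true = w , w≗off-x∷β , ψ-true
    where
    w≗off-x∷β : ∀ a → a ∉ x ∷ β → w a ≡ v a
    w≗off-x∷β a a∉ = trans (w≗off-β a (a∉ ∘ there)) (update-other v x b a (a∉ ∘ here))

  eval-literal : ∀ {v} b a → v a ≡ b → eval 𝒯 v (litFormula 𝒯 (b , a)) ≡ true
  eval-literal true  a va≡b = va≡b
  eval-literal false a va≡b = cong not va≡b

  eval-assignment : ∀ {v} α τ → (∀ a → a ∈ α → v a ≡ τ a) →
                    eval 𝒯 v (assignment 𝒯 α τ) ≡ true
  eval-assignment []      τ v≗τ = refl
  eval-assignment (x ∷ α) τ v≗τ = cong₂ _∧_
    (eval-literal (τ x) x (v≗τ x (here refl)))
    (eval-assignment α τ (λ a a∈α → v≗τ a (there a∈α)))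

  bigAnd-T-lemmas : ∀ M (Cs : List (Clause 𝒯)) → All (T-lemma 𝒯) Cs →
                    _⊨T_ 𝒯 M (bigAnd 𝒯 (map (clauseFormula 𝒯) Cs))
  bigAnd-T-lemmas M []       []             = refl
  bigAnd-T-lemmas M (c ∷ Cs) (C-valid ∷ Cs-valid) =
    cong₂ _∧_ (C-valid M) (bigAnd-T-lemmas M Cs Cs-valid)

  eval-¬[∨¬] : ∀ v (φ χ : Formula 𝒯) → eval 𝒯 v (¬f (φ ∨f (¬f χ))) ≡ true →
               eval 𝒯 v (¬f φ) ≡ true × eval 𝒯 v χ ≡ true
  eval-¬[∨¬] v φ χ p =
    cong not (∨-conicalˡ _ _ φ∨¬χ-false) , not-injective (∨-conicalʳ _ _ φ∨¬χ-false)
    where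
    φ∨¬χ-false : eval 𝒯 v φ ∨ not (eval 𝒯 v χ) ≡ false
    φ∨¬χ-false = not-injective p

  module _ (β : List Atom) (Cs : List (Clause 𝒯)) (φ : Formula 𝒯) where

    private
      ⋀Cs : Formula 𝒯
      ⋀Cs = bigAnd 𝒯 (map (clauseFormula 𝒯) Cs)

    Text-≡T : All (T-lemma 𝒯) Cs → _≡T_ 𝒯 (Text 𝒯 β Cs φ) φ
    Text-≡T Cs-valid M = begin
      eval 𝒯 (holds M) φ ∨ not (eval 𝒯 (holds M) (∃ps 𝒯 β ⋀Cs))
        ≡⟨ cong (λ b → eval 𝒯 (holds M) φ ∨ not b)
                (∃ps-intro β ⋀Cs (holds M) (bigAnd-T-lemmas M Cs Cs-valid)) ⟩
      eval 𝒯 (holds M) φ ∨ false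
        ≡⟨ ∨-identityʳ _ ⟩
      eval 𝒯 (holds M) φ ∎
      where open ≡-Reasoning

    ⊨p-Text : _⊨p_ 𝒯 φ (Text 𝒯 β Cs φ)
    ⊨p-Text v φ-true = cong (_∨ _) φ-true

    Text-T-extended : ∀ α → All (_∉ α) β → RulesOut 𝒯 Cs (P 𝒯 α (¬f φ)) →
                      T-extended 𝒯 α (Text 𝒯 β Cs φ)
    Text-T-extended α β∩α≡∅ ruled-out .(assignment 𝒯 α τ) ((τ , refl) , ρ-unsat , ρ⊨¬Text)
      with eval-¬[∨¬] τ φ (∃ps 𝒯 β ⋀Cs) (ρ⊨¬Text τ (eval-assignment α τ (λ _ _ → refl)))
    ... | _ , ∃Cs-true with ∃ps-elim τ β ⋀Cs ∃Cs-true
    ... | w , w≗off-β , Cs-true =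
      ruled-out w ((ρ , ((τ , refl) , ρ-unsat , ρ⊨¬φ) , ρ-true) , Cs-true)
      where
      ρ : Formula 𝒯
      ρ = assignment 𝒯 α τ

      ρ⊨¬φ : _⊨p_ 𝒯 ρ (¬f φ)
      ρ⊨¬φ v ρ-holds = proj₁ (eval-¬[∨¬] v φ (∃ps 𝒯 β ⋀Cs) (ρ⊨¬Text v ρ-holds))

      ρ-true : eval 𝒯 w ρ ≡ true
      ρ-true = eval-assignment α τ (λ a a∈α → w≗off-β a (λ a∈β → All.lookup β∩α≡∅ a∈β a∈α))

theorem4p18 : (𝒯 : Theory) → let open Theory 𝒯 in
    (φ : Formula 𝒯) (α β : List Atom) (Cs : List (Clause 𝒯)) →
    All (_∈ α) (atoms 𝒯 φ) →
    All (_∉ α) β →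
    All (λ c → T-lemma 𝒯 c × ClauseOn 𝒯 (α ++ β) c) Cs →
    RulesOut 𝒯 Cs (P 𝒯 α (¬f_ φ)) →
    _≡T_ 𝒯 (Text 𝒯 β Cs φ) φ
    × _⊨p_ 𝒯 φ (Text 𝒯 β Cs φ)
    × T-extended 𝒯 α (Text 𝒯 β Cs φ)
theorem4p18 𝒯 φ α β Cs _ β∩α≡∅ Cs-lemmas ruled-out =
    Text-≡T 𝒯 β Cs φ (All.map proj₁ Cs-lemmas)
  , ⊨p-Text 𝒯 β Cs φ
  , Text-T-extended 𝒯 β Cs φ α β∩α≡∅ ruled-out
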